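{- For every integer $n \geq 3$, the $3$-token graph of the path $P_n$ is isomorphic to the cubical staircase graph: $\Gamma_3(P_n) \cong CS_n$.
   Context: All graphs are finite, simple and undirected. $P_n$ is the path with vertices $x_1,\dots,x_n$ and edges $x_ix_{i+1}$ ($1\le i\le n-1$). The $3$-token graph $\Gamma_3(G)$ has as vertices the $3$-element subsets of $V(G)$, two distinct subsets $A,B$ being adjacent iff $A\triangle B=\{x,y\}$ with $xy\in E(G)$. For $n \geq 3$, the cubical staircase graph $CS_n$ is the graph with vertex set $\{(i,j,k) : 1 \leq i \leq n-2,\ 1 \leq j \leq i,\ 1 \leq k \leq n-1-i\}$ and edge set consisting of the pairs $(i,j,k)(i,j,k+1)$ for $1\le i\le n-2$, $1\le j\le i$, $1\le k\le n-2-i$; the pairs $(i,j,k)(i+1,j,k)$ for $1\le i\le n-3$, $1\le j\le i$, $1\le k\le n-1-i$; and the pairs $(i,j,k)(i,j+1,k)$ for $1\le i\le n-2$, $1\le j\le i-1$, $1\le k\le n-1-i$ (only pairs of vertices of $CS_n$ are included). -}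

module Defs where

open import Level using (0ℓ)
open import Data.Nat using (ℕ; zero; suc; _≤_; _∸_)
open import Data.Fin using (Fin; toℕ)
open import Data.Fin.Subset using (Subset; ∣_∣; _∪_; ⁅_⁆)
open import Data.Product using (Σ; _×_; _,_; proj₁)
open import Data.Sum using (_⊎_)
open import Relation.Binary.PropositionalEquality using (_≡_)
open import Function.Bundles using (_⤖_; _⇔_; Bijection)

record Graph : Set₁ where
  field
    V : Set
    E : V → V → Set
open Graph public

_≅_ : Graph → Graph → Set
G ≅ H = Σ (V G ⤖ V H) λ f →
  ∀ u v → E G u v ⇔ E H (Bijection.to f u) (Bijection.to f v)

-- The path P_n on vertices x_1..x_n, represented by Fin n (x_{i+1} ↦ i).
PathAdj : (n : ℕ) → Fin n → Fin n → Set
PathAdj n x y = (toℕ y ≡ suc (toℕ x)) ⊎ (toℕ x ≡ suc (toℕ y))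

P : ℕ → Graph
P n = record { V = Fin n ; E = PathAdj n }

_△_ : ∀ {n} → Subset n → Subset n → Subset n
_△_ {n} A B = Data.Vec.zipWith Data.Bool._xor_ A B
  where import Data.Vec ; import Data.Bool

Token3 : (n : ℕ) → (Fin n → Fin n → Set) → Graph
Token3 n Adj = record
  { V = Σ (Subset n) (λ A → ∣ A ∣ ≡ 3)
  ; E = λ A B → Σ (Fin n) λ x → Σ (Fin n) λ y →
          Adj x y × ((proj₁ A △ proj₁ B) ≡ (⁅ x ⁆ ∪ ⁅ y ⁆))
  }

InCS : ℕ → ℕ × ℕ × ℕ → Set
InCS n (i , j , k) = (1 ≤ i × i ≤ n ∸ 2) × (1 ≤ j × j ≤ i) × (1 ≤ k × k ≤ n ∸ 1 ∸ i)

CSStep : ℕ × ℕ × ℕ → ℕ × ℕ × ℕ → Set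
CSStep (i , j , k) v =
  (v ≡ (i , j , suc k)) ⊎ (v ≡ (suc i , j , k)) ⊎ (v ≡ (i , suc j , k))

CS : ℕ → Graph
CS n = record
  { V = Σ (ℕ × ℕ × ℕ) (InCS n)
  ; E = λ u v → CSStep (proj₁ u) (proj₁ v) ⊎ CSStep (proj₁ v) (proj₁ u)
  }

{-# OPTIONS --safe #-}
-- A 3-subset {p < q < r} of the path x₀ … x_{n-1} is determined by its four gaps
-- (a , b , c , d) = (p , q - p - 1 , r - q - 1 , n - 1 - r), which sum to n - 3.
-- Sliding a token to a free neighbour moves one unit between two adjacent gaps, and
-- conversely. The coordinates (a + b + 1 , a + 1 , d + 1) = (q , p + 1 , n - r) identify
-- such compositions with the vertices of CS_n (c is recovered from n), and the three
-- kinds of unit transfers with the three edge directions of CS_n.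
module Submission where

open import Defs
open import Data.Bool using (Bool; true; false; _xor_)
open import Data.Bool.Properties using (xor-same; xor-comm)
open import Data.Empty using (⊥-elim)
open import Data.Fin using (Fin; zero; suc; toℕ)
open import Data.Fin.Subset using (Subset; ∣_∣; _∪_; ⁅_⁆; ⊥)
open import Data.Fin.Subset.Properties using (∪-comm; ∪-idem)
open import Data.List using (List; []; _∷_; map)
import Data.List.Properties as List
open import Data.List.NonEmpty using (List⁺; _∷_; _∷⁺_; head; tail; toList; length)
open import Data.Nat using (ℕ; zero; suc; _+_; _∸_; _≤_; z≤n; s≤s; z<s)
open import Data.Nat.ListAction using (sum)
open import Data.Nat.Properties
open import Data.Nat.Tactic.RingSolver using (solve-∀)
open import Data.Product using (Σ; ∃; _×_; _,_; proj₁; uncurry)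
open import Data.Product.Properties using (,-injectiveˡ; ,-injectiveʳ)
open import Data.Sum using (_⊎_; inj₁; inj₂; [_,_])
import Data.Sum as Sum
open import Data.Vec using (Vec; []; _∷_)
open import Data.Vec.Properties using (∷-injectiveˡ; ∷-injectiveʳ; zipWith-comm)
open import Function.Base using (_∘_)
open import Function.Bundles using (_⇔_; mk⤖; mk⇔; Bijection)
open import Function.Construct.Composition using (_⤖-∘_; _⇔-∘_)
open import Function.Definitions using (Injective; Surjective)
open import Relation.Binary.PropositionalEquality
  using (_≡_; refl; sym; trans; cong; cong₂; subst; module ≡-Reasoning)
open import Relation.Nullary.Irrelevant using (Irrelevant)

private variable
  n k a b c c′ d g h h′ i j : ℕ
  x : Bool
  gs hs : List ℕ
  X Y : List⁺ ℕ
  A B v w : Vec Bool n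
  t : ℕ × ℕ × ℕ

≅-trans : ∀ {G H K} → G ≅ H → H ≅ K → G ≅ K
≅-trans (f , f-adj) (g , g-adj) =
  g ⤖-∘ f , λ u v → g-adj (Bijection.to f u) (Bijection.to f v) ⇔-∘ f-adj u v

-- Definitionally the adjacency of Token3 n (PathAdj n), on the underlying subsets.
Move : Subset n → Subset n → Set
Move {n} A B = Σ (Fin n) λ x → Σ (Fin n) λ y → PathAdj n x y × A △ B ≡ ⁅ x ⁆ ∪ ⁅ y ⁆

data Slide : Vec Bool n → Vec Bool n → Set where
  here  : Slide (true ∷ false ∷ v) (false ∷ true ∷ v)
  there : Slide v w → Slide (x ∷ v) (x ∷ w)

△-self : (A : Subset n) → A △ A ≡ ⊥
△-self []      = refl
△-self (a ∷ A) = cong₂ _∷_ (xor-same a) (△-self A)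

xor≡false⇒≡ : ∀ {a b} → a xor b ≡ false → a ≡ b
xor≡false⇒≡ {true}  {true}  _ = refl
xor≡false⇒≡ {false} {false} _ = refl

△≡⊥⇒≡ : A △ B ≡ ⊥ → A ≡ B
△≡⊥⇒≡ {A = []}    {[]}    _ = refl
△≡⊥⇒≡ {A = a ∷ A} {b ∷ B} e =
  cong₂ _∷_ (xor≡false⇒≡ (∷-injectiveˡ e)) (△≡⊥⇒≡ (∷-injectiveʳ e))

slide⇒move : Slide A B → Move A B
slide⇒move (here {v = v}) =
  zero , suc zero , inj₁ refl , cong (λ C → true ∷ true ∷ C) (trans (△-self v) (sym (∪-idem ⊥)))
slide⇒move (there {x = a} s) with slide⇒move s
... | x , y , adj , e =
  suc x , suc y , Sum.map (cong suc) (cong suc) adj , cong₂ _∷_ (xor-same a) e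

∣∷∣-cancel : ∀ a {A B : Subset n} → ∣ a ∷ A ∣ ≡ ∣ a ∷ B ∣ → ∣ A ∣ ≡ ∣ B ∣
∣∷∣-cancel true  = suc-injective
∣∷∣-cancel false = λ e → e

swap⇒slide : ∀ {a a′ b b′} → a xor b ≡ true → a′ xor b′ ≡ true →
             ∣ a ∷ a′ ∷ A ∣ ≡ ∣ b ∷ b′ ∷ A ∣ →
             Slide (a ∷ a′ ∷ A) (b ∷ b′ ∷ A) ⊎ Slide (b ∷ b′ ∷ A) (a ∷ a′ ∷ A)
swap⇒slide {a = true}  {false} {false} {true}  _ _ _ = inj₁ here
swap⇒slide {a = false} {true}  {true}  {false} _ _ _ = inj₂ here
swap⇒slide {a = true}  {true}  {false} {false} _ _ c = ⊥-elim (m≢1+n+m _ (sym c))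
swap⇒slide {a = false} {false} {true}  {true}  _ _ c = ⊥-elim (m≢1+n+m _ c)

rightMove⇒slide : (x y : Fin n) → toℕ y ≡ suc (toℕ x) → A △ B ≡ ⁅ x ⁆ ∪ ⁅ y ⁆ →
                  ∣ A ∣ ≡ ∣ B ∣ → Slide A B ⊎ Slide B A
rightMove⇒slide {A = a ∷ a′ ∷ A} {b ∷ b′ ∷ B} zero (suc zero) _ e c
  with △≡⊥⇒≡ (trans (∷-injectiveʳ (∷-injectiveʳ e)) (∪-idem ⊥))
... | refl = swap⇒slide (∷-injectiveˡ e) (∷-injectiveˡ (∷-injectiveʳ e)) c
rightMove⇒slide {A = a ∷ A} {b ∷ B} (suc x) (suc y) y≡1+x e c
  with xor≡false⇒≡ {a} {b} (∷-injectiveˡ e)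
... | refl = Sum.map there there
  (rightMove⇒slide x y (suc-injective y≡1+x) (∷-injectiveʳ e) (∣∷∣-cancel a {A} {B} c))

Move-sym : Move A B → Move B A
Move-sym {A = A} {B} (x , y , adj , e) =
  y , x , Sum.swap adj , trans (zipWith-comm xor-comm B A) (trans e (∪-comm ⁅ x ⁆ ⁅ y ⁆))

move⇒slide : ∣ A ∣ ≡ ∣ B ∣ → Move A B → Slide A B ⊎ Slide B A
move⇒slide c (x , y , inj₁ y≡1+x , e) = rightMove⇒slide x y y≡1+x e c
move⇒slide c (x , y , inj₂ x≡1+y , e) =
  rightMove⇒slide y x x≡1+y (trans e (∪-comm ⁅ x ⁆ ⁅ y ⁆)) c

gaps : Vec Bool n → List⁺ ℕ
gaps []          = 0 ∷ []
gaps (true ∷ v)  = 0 ∷⁺ gaps v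
gaps (false ∷ v) = suc (head (gaps v)) ∷ tail (gaps v)

span : List⁺ ℕ → ℕ
span (g ∷ gs) = g + sum (map suc gs)

length-gaps : (v : Vec Bool n) → length (gaps v) ≡ suc ∣ v ∣
length-gaps []          = refl
length-gaps (true ∷ v)  = cong suc (length-gaps v)
length-gaps (false ∷ v) = length-gaps v

span-gaps : (v : Vec Bool n) → span (gaps v) ≡ n
span-gaps []          = refl
span-gaps (true ∷ v)  = cong suc (span-gaps v)
span-gaps (false ∷ v) = cong suc (span-gaps v)

toList-injective : toList X ≡ toList Y → X ≡ Y
toList-injective e = cong₂ _∷_ (List.∷-injectiveˡ e) (List.∷-injectiveʳ e)

gaps-injective : gaps v ≡ gaps w → v ≡ w
gaps-injective {v = []}        {[]}        _ = refl
gaps-injective {v = true ∷ v}  {true ∷ w}  e =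
  cong (true ∷_) (gaps-injective (toList-injective (cong tail e)))
gaps-injective {v = false ∷ v} {false ∷ w} e =
  cong (false ∷_) (gaps-injective (cong₂ _∷_ (suc-injective (cong head e)) (cong tail e)))
gaps-injective {v = true ∷ v}  {false ∷ w} e with cong head e
... | ()
gaps-injective {v = false ∷ v} {true ∷ w}  e with cong head e
... | ()

gaps-surjective : ∀ g gs → span (g ∷ gs) ≡ n → ∃ λ (v : Vec Bool n) → gaps v ≡ g ∷ gs
gaps-surjective zero    []       refl = [] , refl
gaps-surjective zero    (h ∷ hs) refl =
  let v , e = gaps-surjective h hs refl in true ∷ v , cong (λ Z → 0 ∷ toList Z) e
gaps-surjective (suc g) gs       refl =
  let v , e = gaps-surjective g gs refl in false ∷ v , cong (λ Z → suc (head Z) ∷ tail Z) e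

data Transfer : List⁺ ℕ → List⁺ ℕ → Set where
  here  : Transfer (g ∷ suc h ∷ gs) (suc g ∷ h ∷ gs)
  there : Transfer (h ∷ gs) (h′ ∷ hs) → Transfer (g ∷ h ∷ gs) (g ∷ h′ ∷ hs)

transfer-span : Transfer X Y → span X ≡ span Y
transfer-span (here {g} {h} {gs}) = +-suc g (suc (h + sum (map suc gs)))
transfer-span (there {g = g} t)   = cong (λ s → g + suc s) (transfer-span t)

transfer-suc : Transfer (g ∷ gs) (h ∷ hs) → Transfer (suc g ∷ gs) (suc h ∷ hs)
transfer-suc here      = here
transfer-suc (there t) = there t

transfer-pred : Transfer (suc g ∷ gs) (suc h ∷ hs) → Transfer (g ∷ gs) (h ∷ hs)
transfer-pred here      = here
transfer-pred (there t) = there t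

slide⇒transfer : Slide v w → Transfer (gaps v) (gaps w)
slide⇒transfer here                  = here
slide⇒transfer (there {x = true} s)  = there (slide⇒transfer s)
slide⇒transfer (there {x = false} s) = transfer-suc (slide⇒transfer s)

front-transfer⇒≡ : Transfer (g ∷ suc h ∷ gs) (suc g ∷ h′ ∷ hs) → h ≡ h′ × gs ≡ hs
front-transfer⇒≡ here = refl , refl

transfer⇒slide : Transfer (gaps v) (gaps w) → Slide v w
transfer⇒slide {v = true ∷ v}  {true ∷ w}  (there t) = there (transfer⇒slide t)
transfer⇒slide {v = false ∷ v} {false ∷ w} t         = there (transfer⇒slide (transfer-pred t))
transfer⇒slide {v = true ∷ false ∷ v} {false ∷ true ∷ w} t
  with gaps-injective {v = v} {w} (uncurry (cong₂ _∷_) (front-transfer⇒≡ t))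
... | refl = here

move⇔transfer : ∣ A ∣ ≡ ∣ B ∣ →
                Move A B ⇔ (Transfer (gaps A) (gaps B) ⊎ Transfer (gaps B) (gaps A))
move⇔transfer c = mk⇔
  (Sum.map slide⇒transfer slide⇒transfer ∘ move⇒slide c)
  ([ slide⇒move , Move-sym ∘ slide⇒move ] ∘ Sum.map transfer⇒slide transfer⇒slide)

Compositions : ℕ → ℕ → Graph
Compositions n k = record
  { V = Σ (List⁺ ℕ) λ X → length X ≡ suc k × span X ≡ n
  ; E = λ X Y → Transfer (proj₁ X) (proj₁ Y) ⊎ Transfer (proj₁ Y) (proj₁ X)
  }

toComposition : Σ (Subset n) (λ A → ∣ A ∣ ≡ k) → V (Compositions n k)
toComposition (A , p) = gaps A , trans (length-gaps A) (cong suc p) , span-gaps A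

toComposition-injective : Injective _≡_ _≡_ (toComposition {n} {k})
toComposition-injective {x = A , p} {B , q} e with gaps-injective (cong proj₁ e)
... | refl = cong (A ,_) (≡-irrelevant p q)

toComposition-surjective : Surjective _≡_ _≡_ (toComposition {n} {k})
toComposition-surjective (g ∷ gs , l , s) with gaps-surjective g gs s
... | A , refl = (A , suc-injective (trans (sym (length-gaps A)) l)) , λ { refl →
  cong (gaps A ,_) (cong₂ _,_ (≡-irrelevant _ _) (≡-irrelevant _ _)) }

span₄ : ∀ a b c d → span (a ∷ b ∷ c ∷ d ∷ []) ≡ suc (suc ((a + b) + (suc d + c)))
span₄ a b c d = normalise a b c d
  where
  normalise : ∀ a b c d → a + (suc b + (suc c + (suc d + 0))) ≡ suc (suc ((a + b) + (suc d + c)))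
  normalise = solve-∀

span₄-cancel : ∀ a b c c′ d →
               span (a ∷ b ∷ c ∷ d ∷ []) ≡ n → span (a ∷ b ∷ c′ ∷ d ∷ []) ≡ n → c ≡ c′
span₄-cancel a b c c′ d s s′ =
  +-cancelˡ-≡ (suc d) c c′ (+-cancelˡ-≡ (a + b) _ _ (suc-injective (suc-injective (begin
    suc (suc ((a + b) + (suc d + c)))  ≡⟨ span₄ a b c d ⟨
    span (a ∷ b ∷ c ∷ d ∷ [])          ≡⟨ trans s (sym s′) ⟩
    span (a ∷ b ∷ c′ ∷ d ∷ [])         ≡⟨ span₄ a b c′ d ⟩
    suc (suc ((a + b) + (suc d + c′))) ∎))))
  where open ≡-Reasoning

inCS-intro : j ≤ i → suc (suc (i + (suc k + c))) ≡ n → InCS n (suc i , suc j , suc k)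
inCS-intro {j} {i} {k} {c} j≤i refl =
  (s≤s z≤n , m<m+n i z<s) , (s≤s z≤n , s≤s j≤i) ,
  (s≤s z≤n , subst (suc k ≤_) (sym (m+n∸m≡n i (suc k + c))) (m≤m+n (suc k) c))

inCS⇒span : InCS n (suc (a + b) , j , suc d) → ∃ λ c → span (a ∷ b ∷ c ∷ d ∷ []) ≡ n
inCS⇒span {suc (suc (suc m))} {a} {b} {d = d} ((_ , s≤s a+b≤m) , _ , (_ , d<)) =
  let c , e = m≤n⇒∃[o]m+o≡n d< in c , (begin
    span (a ∷ b ∷ c ∷ d ∷ [])               ≡⟨ span₄ a b c d ⟩
    suc (suc ((a + b) + (suc d + c)))       ≡⟨ cong (λ x → suc (suc ((a + b) + x))) e ⟩
    suc (suc ((a + b) + (suc m ∸ (a + b)))) ≡⟨ cong (2 +_) (m+[n∸m]≡n (m≤n⇒m≤1+n a+b≤m)) ⟩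
    suc (suc (suc m))                       ∎)
  where open ≡-Reasoning

inCS-irrelevant : Irrelevant (InCS n t)
inCS-irrelevant ((p₁ , p₂) , (p₃ , p₄) , (p₅ , p₆)) ((q₁ , q₂) , (q₃ , q₄) , (q₅ , q₆)) =
  cong₂ _,_ (≤-pair p₁ q₁ p₂ q₂) (cong₂ _,_ (≤-pair p₃ q₃ p₄ q₄) (≤-pair p₅ q₅ p₆ q₆))
  where
  ≤-pair : ∀ {m m′ o o′} (p q : m ≤ m′) (p′ q′ : o ≤ o′) → (p , p′) ≡ (q , q′)
  ≤-pair p q p′ q′ = cong₂ _,_ (≤-irrelevant p q) (≤-irrelevant p′ q′)

toCS : V (Compositions n 3) → V (CS n)
toCS (a ∷ b ∷ c ∷ d ∷ [] , refl , s) =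
  (suc (a + b) , suc a , suc d) , inCS-intro (m≤m+n a b) (trans (sym (span₄ a b c d)) s)

toCS-injective : Injective _≡_ _≡_ (toCS {n})
toCS-injective {x = a ∷ b ∷ c ∷ d ∷ [] , refl , s} {a′ ∷ b′ ∷ c′ ∷ d′ ∷ [] , refl , s′} e
  with refl ← ,-injectiveʳ (,-injectiveˡ e)
  with refl ← +-cancelˡ-≡ a b b′ (suc-injective (,-injectiveˡ (,-injectiveˡ e)))
  with refl ← span₄-cancel a b c c′ d s s′
  = cong (λ s → _ , refl , s) (≡-irrelevant s s′)

toCS-surjective : Surjective _≡_ _≡_ (toCS {n})
toCS-surjective {n} ((suc i , suc a , suc d) , p@(_ , (_ , s≤s a≤i) , _))
  with b , refl ← m≤n⇒∃[o]m+o≡n a≤i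
  with c , s ← inCS⇒span p
  = (a ∷ b ∷ c ∷ d ∷ [] , refl , s) , λ { refl → cong (_ ,_) (inCS-irrelevant {n} _ _) }

transfer⇒csAdj : ∀ (u w : V (Compositions n 3)) →
                 Transfer (proj₁ u) (proj₁ w) → E (CS n) (toCS u) (toCS w)
transfer⇒csAdj (a ∷ suc b ∷ c ∷ d ∷ [] , refl , _) (_ , refl , _) here =
  inj₁ (inj₂ (inj₂ (cong (λ i → suc i , suc (suc a) , suc d) (sym (+-suc a b)))))
transfer⇒csAdj (a ∷ b ∷ suc c ∷ d ∷ [] , refl , _) (_ , refl , _) (there here) =
  inj₁ (inj₂ (inj₁ (cong (λ i → suc i , suc a , suc d) (+-suc a b))))
transfer⇒csAdj (_ ∷ _ ∷ _ ∷ _ ∷ [] , refl , _) (_ , refl , _) (there (there here)) =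
  inj₂ (inj₁ refl)

-- In each case a, b and d are read off the coordinates, and c is then forced by the
-- common span n.
csStep⇒transfer : ∀ (u w : V (Compositions n 3)) →
                  CSStep (proj₁ (toCS u)) (proj₁ (toCS w)) → E (Compositions n 3) u w
csStep⇒transfer (a ∷ b ∷ c ∷ d ∷ [] , refl , s) (a′ ∷ b′ ∷ c′ ∷ d′ ∷ [] , refl , s′) (inj₁ e)
  with refl ← ,-injectiveʳ e
  with refl ← +-cancelˡ-≡ a b′ b (suc-injective (,-injectiveˡ e))
  with refl ← span₄-cancel a b c (suc c′) d s
                (trans (sym (transfer-span {X = a ∷ b ∷ c′ ∷ suc d ∷ []} (there (there here)))) s′)
  = inj₂ (there (there here))
csStep⇒transfer (a ∷ b ∷ c ∷ d ∷ [] , refl , s) (a′ ∷ b′ ∷ c′ ∷ d′ ∷ [] , refl , s′) (inj₂ (inj₁ e))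
  with refl ← ,-injectiveʳ e
  with refl ← +-cancelˡ-≡ a b′ (suc b) (trans (suc-injective (,-injectiveˡ e)) (sym (+-suc a b)))
  with refl ← span₄-cancel a b c (suc c′) d s
                (trans (transfer-span {X = a ∷ b ∷ suc c′ ∷ d ∷ []} (there here)) s′)
  = inj₁ (there here)
csStep⇒transfer (a ∷ b ∷ c ∷ d ∷ [] , refl , s) (a′ ∷ b′ ∷ c′ ∷ d′ ∷ [] , refl , s′) (inj₂ (inj₂ e))
  with refl ← ,-injectiveʳ e
  with refl ← +-cancelˡ-≡ a b (suc b′) (sym (trans (+-suc a b′) (suc-injective (,-injectiveˡ e))))
  with refl ← span₄-cancel a (suc b′) c c′ d s
                (trans (transfer-span {X = a ∷ suc b′ ∷ c′ ∷ d ∷ []} here) s′)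
  = inj₁ here

token3≅compositions : Token3 n (PathAdj n) ≅ Compositions n 3
token3≅compositions = mk⤖ (toComposition-injective , toComposition-surjective) ,
  λ (A , p) (B , q) → move⇔transfer (trans p (sym q))

compositions≅CS : Compositions n 3 ≅ CS n
compositions≅CS = mk⤖ (toCS-injective , toCS-surjective) , λ u w → mk⇔
  [ transfer⇒csAdj u w , Sum.swap ∘ transfer⇒csAdj w u ]
  [ csStep⇒transfer u w , Sum.swap ∘ csStep⇒transfer w u ]

theorem7 : (n : ℕ) → 3 ≤ n → Token3 n (E (P n)) ≅ CS n
theorem7 n _ = ≅-trans {H = Compositions n 3} {K = CS n} token3≅compositions compositions≅CS
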